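{- Let $\le$ be a partial order on $SYT_n$ having the inner translation property. Let $1\le k<n$, let $S,T\in SYT_n$ and $R,R'\in SYT_k$ with $S_{[1,k]}=T_{[1,k]}=R$ and $\mathrm{sh}(R)=\mathrm{sh}(R')$, and let $S',T'\in SYT_n$ be obtained from $S$ and $T$ by replacing the subtableau $R$ by $R'$. Then $S\le T$ if and only if $S'\le T'$. In particular, the subposets $(SYT_n^R,\le)$ and $(SYT_n^{R'},\le)$ of $(SYT_n,\le)$ are isomorphic, where $SYT_n^R=\{T\in SYT_n:T_{[1,k]}=R\}$.
   Context: $SYT_n$: standard Young tableaux with $n$ cells; $T_{[1,k]}$ is the subtableau of $T$ formed by entries $1,\dots,k$. $\mathrm{Des}(T)=\{i\in[n-1]: i+1$ lies in a row strictly below the row of $i\}$; $r_T(j)$ denotes the row number (from the top) of $j$ in $T$. For $i\in[n-2]$ and $\{\alpha,\beta\}=\{i,i+1\}$ let $SYT_n^{[\alpha,\beta]}=\{T\in SYT_n:\alpha\in\mathrm{Des}(T),\ \beta\notin\mathrm{Des}(T)\}$. The inner translation map $\mathcal V_{[\alpha,\beta]}:SYT_n^{[\alpha,\beta]}\to SYT_n^{[\beta,\alpha]}$ (a single dual Knuth relation on $\{i,i+1,i+2\}$) is defined as follows. If $i+1\in\mathrm{Des}(T)$, $i\notin\mathrm{Des}(T)$: when $r_T(i+2)>r_T(i)\ge r_T(i+1)$ interchange $i+1$ and $i+2$; when $r_T(i)\ge r_T(i+2)>r_T(i+1)$ interchange $i$ and $i+1$. If $i\in\mathrm{Des}(T)$,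 $i+1\notin\mathrm{Des}(T)$: when $r_T(i+1)>r_T(i)\ge r_T(i+2)$ interchange $i+1$ and $i+2$; when $r_T(i+1)\ge r_T(i+2)>r_T(i)$ interchange $i$ and $i+1$. The order $\le$ has the inner translation property if every map $\mathcal V_{[\alpha,\beta]}:(SYT_n^{[\alpha,\beta]},\le)\to(SYT_n^{[\beta,\alpha]},\le)$ is order-preserving. -}

module Defs where

open import Level using (Level)
import Data.Nat
open import Data.Nat.Properties using (≤-trans; n≤1+n)
open import Data.Nat using (ℕ; zero; suc; _≤_; _<_; _+_)
open import Data.Fin as Fin using (Fin; toℕ; fromℕ<; inject≤)
open import Data.Product using (Σ; ∃; _×_; _,_; proj₁; proj₂)
open import Data.Sum using (_⊎_)
open import Relation.Nullary using (¬_)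
open import Relation.Binary.Core using (Rel)
open import Relation.Binary.PropositionalEquality using (_≡_; _≢_)
open import Function.Bundles using (_⇔_)

-- Cells are (row , column), both 0-indexed, English convention.
-- Entries of a tableau with n cells are Fin n; entry x stands for the
-- number (toℕ x + 1) in the paper.

record SYT (n : ℕ) : Set where
  field
    pos        : Fin n → ℕ × ℕ
    injective  : ∀ x y → pos x ≡ pos y → x ≡ y
    downClosed : ∀ x r c → r ≤ proj₁ (pos x) → c ≤ proj₂ (pos x) →
                 ∃ λ y → pos y ≡ (r , c)
    increasing : ∀ x y → proj₁ (pos x) ≤ proj₁ (pos y) →
                 proj₂ (pos x) ≤ proj₂ (pos y) → toℕ x ≤ toℕ y

open SYT public

row : ∀ {n} → SYT n → Fin n → ℕ
row T x = proj₁ (pos T x)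

_≈ᵀ_ : ∀ {n} → Rel (SYT n) Level.zero
S ≈ᵀ T = ∀ j → pos S j ≡ pos T j

SameShape : ∀ {k} → SYT k → SYT k → Set
SameShape R R' = ∀ c → (∃ λ j → pos R j ≡ c) ⇔ (∃ λ j → pos R' j ≡ c)

Restricts : ∀ {n k} → k ≤ n → SYT n → SYT k → Set
Restricts k≤n T R = ∀ (j : Fin _) → pos T (inject≤ j k≤n) ≡ pos R j

Replaced : ∀ {n k} → k ≤ n → SYT n → SYT k → SYT n → Set
Replaced {n} {k} k≤n S R' S' =
  Restricts k≤n S' R' × (∀ (j : Fin n) → k ≤ toℕ j → pos S' j ≡ pos S j)

SubSYT : ∀ {n k} → k ≤ n → SYT k → Set
SubSYT {n} k≤n R = Σ (SYT n) λ T → Restricts k≤n T R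

Swap : ∀ {n} → SYT n → Fin n → Fin n → SYT n → Set
Swap {n} T x y T' =
  pos T' x ≡ pos T y × pos T' y ≡ pos T x ×
  (∀ (j : Fin n) → j ≢ x → j ≢ y → pos T' j ≡ pos T j)

-- For a with a + 3 ≤ n, the paper's i = a + 1 ∈ [n-2]; the three entries
-- i, i+1, i+2 are e₀, e₁, e₂ below.
module Triple {n : ℕ} (a : ℕ) (p : suc (suc (suc a)) ≤ n) where
  e₀ e₁ e₂ : Fin n
  e₀ = fromℕ< {a} {n} (≤-trans (n≤1+n (suc a)) (≤-trans (n≤1+n (suc (suc a))) p))
  e₁ = fromℕ< {suc a} {n} (≤-trans (n≤1+n (suc (suc a))) p)
  e₂ = fromℕ< {suc (suc a)} {n} p

  DesI DesI+1 : SYT n → Set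
  DesI T   = row T e₁ > row T e₀  where open Data.Nat using (_>_)
  DesI+1 T = row T e₂ > row T e₁  where open Data.Nat using (_>_)

  Dom[i+1,i] Dom[i,i+1] : SYT n → Set
  Dom[i+1,i] T = DesI+1 T × ¬ DesI T
  Dom[i,i+1] T = DesI T × ¬ DesI+1 T

  V[i+1,i] : SYT n → SYT n → Set
  V[i+1,i] T T' =
    (row T e₂ > row T e₀ × row T e₀ ≥ row T e₁ × Swap T e₁ e₂ T') ⊎
    (row T e₀ ≥ row T e₂ × row T e₂ > row T e₁ × Swap T e₀ e₁ T')
    where open Data.Nat using (_>_; _≥_)

  V[i,i+1] : SYT n → SYT n → Set
  V[i,i+1] T T' =
    (row T e₁ > row T e₀ × row T e₀ ≥ row T e₂ × Swap T e₁ e₂ T') ⊎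
    (row T e₁ ≥ row T e₂ × row T e₂ > row T e₀ × Swap T e₀ e₁ T')
    where open Data.Nat using (_>_; _≥_)

InnerTranslationProperty : ∀ {ℓ n} → Rel (SYT n) ℓ → Set ℓ
InnerTranslationProperty {n = n} _≼_ =
  ∀ (a : ℕ) (p : suc (suc (suc a)) ≤ n) →
    (∀ T₁ T₂ U₁ U₂ → Dom[i+1,i] a p T₁ → Dom[i+1,i] a p T₂ →
       V[i+1,i] a p T₁ U₁ → V[i+1,i] a p T₂ U₂ → T₁ ≼ T₂ → U₁ ≼ U₂) ×
    (∀ T₁ T₂ U₁ U₂ → Dom[i,i+1] a p T₁ → Dom[i,i+1] a p T₂ →
       V[i,i+1] a p T₁ U₁ → V[i,i+1] a p T₂ U₂ → T₁ ≼ T₂ → U₁ ≼ U₂)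
  where open Triple

-- An inner translation of Q ∈ SYT_k exchanges two of the entries i, i+1, i+2 ≤ k, and whether
-- it applies depends only on the rows of these three entries. Hence for every S with S_[1,k] = Q
-- it lifts to an inner translation of S which replaces Q by its image and fixes the entries > k;
-- applying it to S and T at once, the inner translation property carries S ≤ T along any chain
-- of inner translations from R to R'. Such a chain exists whenever sh(R) = sh(R'), by induction
-- on k: move the entry k of R into the corner c holding k in R', then connect the restrictions
-- to [1,k-1] and lift. To move k into c: by induction, first bring k-1 into c. Of c and the cell
-- of k, one lies in a row t+1 directly below an entry smaller than k-1; so the greatest entry
-- smaller than k-1 in row t sits in a corner of T_[1,k-2], and by induction k-2 can be brought
-- there. Now i = k-2 admits an inner translation exchanging k-1 and k.

{-# OPTIONS --safe #-}
module Submission where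

open import Defs
open import Level using (Level)
open import Data.Nat using (ℕ; zero; suc; _≤_; _<_; z≤n; s≤s; _<?_)
  renaming (_≟_ to _≟ℕ_)
open import Data.Nat.Properties
  using (≤-refl; ≤-trans; ≤-antisym; ≤-total; ≤-reflexive; ≤-pred; <⇒≤; <⇒≱; ≮⇒≥; ≤∧≢⇒<; ≤-<-trans;
         <-≤-trans; <-irrefl; <-cmp; n≤1+n; n<1+n; m<n⇒m<1+n; m≤n+m; 1+n≢n)
open import Data.Nat.Induction using (<-rec)
open import Data.Fin as Fin using (Fin; toℕ; fromℕ<; inject≤)
open import Data.Fin.Properties
  using (toℕ-injective; toℕ-fromℕ<; fromℕ<-toℕ; toℕ-inject≤; inject≤-injective; toℕ<n; any?)
  renaming (_≟_ to _≟ᶠ_)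
open import Data.Product using (Σ; ∃; ∃₂; _×_; _,_; proj₁; proj₂; map₂)
open import Data.Product.Properties using (≡-dec)
open import Data.Sum using (_⊎_; inj₁; inj₂)
import Data.Sum as Sum
open import Data.Empty using (⊥-elim)
open import Function using (_∘_)
open import Relation.Nullary using (¬_; Dec; yes; no)
open import Relation.Nullary.Decidable using (_×-dec_)
open import Relation.Unary using (Pred; Decidable)
open import Relation.Binary.Core using (Rel)
open import Relation.Binary.Definitions using (tri<; tri≈; tri>)
open import Relation.Binary.Structures using (IsPartialOrder)
open import Relation.Binary.PropositionalEquality
open import Relation.Binary.Construct.Closure.ReflexiveTransitive using (Star; ε; _◅_; _◅◅_)
open import Function.Bundles using (_⇔_; mk⇔; Equivalence)
open import Function.Construct.Composition using (_⇔-∘_)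
open import Function.Construct.Symmetry using (⇔-sym)

Cell : ∀ {n} → SYT n → ℕ × ℕ → Set
Cell T p = ∃ λ x → pos T x ≡ p

col : ∀ {n} → SYT n → Fin n → ℕ
col T x = proj₂ (pos T x)

_⊑_ : ℕ × ℕ → ℕ × ℕ → Set
(r , c) ⊑ (r' , c') = r ≤ r' × c ≤ c'

below right : ℕ × ℕ → ℕ × ℕ
below (r , c) = (suc r , c)
right (r , c) = (r , suc c)

Corner : ∀ {n} → SYT n → ℕ × ℕ → Set
Corner T p = Cell T p × ¬ Cell T (below p) × ¬ Cell T (right p)

entry-monotone : ∀ {n} (T : SYT n) {x y p q} → pos T x ≡ p → pos T y ≡ q → p ⊑ q → toℕ x ≤ toℕ y
entry-monotone T refl refl (r≤r' , c≤c') = increasing T _ _ r≤r' c≤c'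

entry-strictMono : ∀ {n} (T : SYT n) {x y p q} → pos T x ≡ p → pos T y ≡ q → p ⊑ q → p ≢ q →
                   toℕ x < toℕ y
entry-strictMono T x↦p y↦q p⊑q p≢q =
  ≤∧≢⇒< (entry-monotone T x↦p y↦q p⊑q)
        (λ x≡y → p≢q (trans (sym x↦p) (trans (cong (pos T) (toℕ-injective x≡y)) y↦q)))

cell-downClosed : ∀ {n} (T : SYT n) {p q} → Cell T q → p ⊑ q → Cell T p
cell-downClosed T (x , refl) (r≤ , c≤) = downClosed T x _ _ r≤ c≤

same-row-col-monotone : ∀ {n} (T : SYT n) {x y} → row T x ≡ row T y → toℕ x ≤ toℕ y → col T x ≤ col T y
same-row-col-monotone T {x} {y} same-row x≤y with ≤-total (col T x) (col T y)
... | inj₁ cx≤cy = cx≤cy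
... | inj₂ cy≤cx = ≤-reflexive (cong (col T) x≡y)
  where
  x≡y = toℕ-injective (≤-antisym x≤y (entry-monotone T refl refl (≤-reflexive (sym same-row) , cy≤cx)))

≈ᵀ⇒sameShape : ∀ {n} {S T : SYT n} → S ≈ᵀ T → SameShape S T
≈ᵀ⇒sameShape S≈T p = mk⇔ (λ (x , e) → x , trans (sym (S≈T x)) e) (λ (x , e) → x , trans (S≈T x) e)

sameShape-sym : ∀ {n} {S T : SYT n} → SameShape S T → SameShape T S
sameShape-sym S~T p = ⇔-sym (S~T p)

sameShape-trans : ∀ {n} {S T U : SYT n} → SameShape S T → SameShape T U → SameShape S U
sameShape-trans S~T T~U p = T~U p ⇔-∘ S~T p

sameShape-corner : ∀ {n} {S T : SYT n} → SameShape S T → ∀ {p} → Corner S p → Corner T p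
sameShape-corner S~T (cell , no-below , no-right) =
  Equivalence.to (S~T _) cell , no-below ∘ Equivalence.from (S~T _) , no-right ∘ Equivalence.from (S~T _)

no-corner-in-empty : (T : SYT 0) {p : ℕ × ℕ} → ¬ Corner T p
no-corner-in-empty T ((() , _) , _)

inject≤-fromℕ< : ∀ {j k n} .(j<k : j < k) .(k≤n : k ≤ n) .(j<n : j < n) →
                 inject≤ (fromℕ< j<k) k≤n ≡ fromℕ< j<n
inject≤-fromℕ< j<k k≤n j<n =
  toℕ-injective (trans (toℕ-inject≤ _ k≤n) (trans (toℕ-fromℕ< j<k) (sym (toℕ-fromℕ< j<n))))

module _ {k n : ℕ} (k≤n : k ≤ n) where

  inject≤-low : (x : Fin k) → toℕ (inject≤ x k≤n) < k
  inject≤-low x = subst (_< k) (sym (toℕ-inject≤ x k≤n)) (toℕ<n x)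

  inject≤-onto : (y : Fin n) → toℕ y < k → ∃ λ x → inject≤ x k≤n ≡ y
  inject≤-onto y y<k = fromℕ< y<k , trans (inject≤-fromℕ< y<k k≤n (toℕ<n y)) (fromℕ<-toℕ y (toℕ<n y))

  lowOrHigh : (z : Fin n) → (∃ λ x → inject≤ x k≤n ≡ z) ⊎ k ≤ toℕ z
  lowOrHigh z with toℕ z <? k
  ... | yes z<k = inj₁ (inject≤-onto z z<k)
  ... | no z≮k  = inj₂ (≮⇒≥ z≮k)

  restrict : SYT n → SYT k
  restrict T = record
    { pos        = λ x → pos T (inject≤ x k≤n)
    ; injective  = λ x y e → inject≤-injective k≤n k≤n x y (injective T _ _ e)
    ; downClosed = λ x r c r≤ c≤ →
        let (y , y↦) = downClosed T _ r c r≤ c≤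
            (x' , x'↦y) = inject≤-onto y (≤-<-trans (entry-monotone T y↦ refl (r≤ , c≤)) (inject≤-low x))
        in x' , trans (cong (pos T) x'↦y) y↦
    ; increasing = λ x y r≤ c≤ →
        subst₂ _≤_ (toℕ-inject≤ x k≤n) (toℕ-inject≤ y k≤n) (increasing T _ _ r≤ c≤)
    }

  restrict-restricts : (T : SYT n) → Restricts k≤n T (restrict T)
  restrict-restricts T x = refl

  restrict-cell : (T : SYT n) {y : Fin n} {p : ℕ × ℕ} → pos T y ≡ p → toℕ y < k → Cell (restrict T) p
  restrict-cell T {y} y↦p y<k = let (x , x↦y) = inject≤-onto y y<k in x , trans (cong (pos T) x↦y) y↦p

  restrict-cell⁻ : (T : SYT n) {p : ℕ × ℕ} → Cell (restrict T) p → ∃ λ z → pos T z ≡ p × toℕ z < k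
  restrict-cell⁻ T (x , x↦p) = inject≤ x k≤n , x↦p , inject≤-low x

  restricts-fromℕ< : ∀ {S : SYT n} {Q : SYT k} → Restricts k≤n S Q →
                     ∀ {j} (j<k : j < k) → pos S (fromℕ< (≤-trans j<k k≤n)) ≡ pos Q (fromℕ< j<k)
  restricts-fromℕ< {S} S|Q j<k = trans (cong (pos S) (sym (inject≤-fromℕ< j<k k≤n (≤-trans j<k k≤n)))) (S|Q _)

  replaced-fromℕ< : ∀ {S S' : SYT n} {Q' : SYT k} → Replaced k≤n S Q' S' →
                    ∀ {j} → k ≤ j → (j<n : j < n) → pos S' (fromℕ< j<n) ≡ pos S (fromℕ< j<n)
  replaced-fromℕ< (_ , high) k≤j j<n = high _ (subst (k ≤_) (sym (toℕ-fromℕ< j<n)) k≤j)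

  ≈ᵀ-from-parts : ∀ {S T : SYT n} {Q : SYT k} → Restricts k≤n S Q → Restricts k≤n T Q →
                  (∀ z → k ≤ toℕ z → pos S z ≡ pos T z) → S ≈ᵀ T
  ≈ᵀ-from-parts S|Q T|Q high z with lowOrHigh z
  ... | inj₁ (x , refl) = trans (S|Q x) (sym (T|Q x))
  ... | inj₂ k≤z        = high z k≤z

  replaced-self : ∀ {S S' : SYT n} {Q : SYT k} → Restricts k≤n S Q → Replaced k≤n S Q S' → S' ≈ᵀ S
  replaced-self {S} {S'} {Q} S|Q (S'|Q , high) = ≈ᵀ-from-parts {S'} {S} {Q} S'|Q S|Q high

  replaced-twice : ∀ {S S' S'' : SYT n} {Q Q' : SYT k} → Restricts k≤n S Q →
                   Replaced k≤n S Q' S' → Replaced k≤n S' Q S'' → S'' ≈ᵀ S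
  replaced-twice {S} {S'} {S''} {Q} S|Q (_ , high') (S''|Q , high'') =
    ≈ᵀ-from-parts {S''} {S} {Q} S''|Q S|Q (λ z k≤z → trans (high'' z k≤z) (high' z k≤z))

  replaced-sym : ∀ {S S' : SYT n} {Q Q' : SYT k} → Restricts k≤n S Q → Replaced k≤n S Q' S' → Replaced k≤n S' Q S
  replaced-sym S|Q (_ , high) = S|Q , λ z k≤z → sym (high z k≤z)

  replaced-rebase : ∀ {S S₁ S' : SYT n} {Q₁ Q' : SYT k} →
                    Replaced k≤n S Q₁ S₁ → Replaced k≤n S Q' S' → Replaced k≤n S₁ Q' S'
  replaced-rebase (_ , high₁) (S'|Q' , high') = S'|Q' , λ z k≤z → trans (high' z k≤z) (sym (high₁ z k≤z))

module Replacement {k n : ℕ} (k≤n : k ≤ n) (S : SYT n) (Q' : SYT k)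
                   (shape : SameShape (restrict k≤n S) Q') where

  position-from : ∀ {z} → (∃ λ x → inject≤ x k≤n ≡ z) ⊎ k ≤ toℕ z → ℕ × ℕ
  position-from         (inj₁ (x , _)) = pos Q' x
  position-from {z = z} (inj₂ _)       = pos S z

  position : Fin n → ℕ × ℕ
  position z = position-from (lowOrHigh k≤n z)

  data View (z : Fin n) : Set where
    low  : ∀ x → inject≤ x k≤n ≡ z → position z ≡ pos Q' x → View z
    high : k ≤ toℕ z → position z ≡ pos S z → View z

  view : ∀ z → View z
  view z with lowOrHigh k≤n z in split
  ... | inj₁ (x , x↦z) = low x x↦z (cong position-from split)
  ... | inj₂ k≤z       = high k≤z (cong position-from split)

  position-low : ∀ x → position (inject≤ x k≤n) ≡ pos Q' x
  position-low x with view (inject≤ x k≤n)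
  ... | low x' e p   = trans p (cong (pos Q') (inject≤-injective k≤n k≤n x' x e))
  ... | high k≤x _   = ⊥-elim (<⇒≱ (inject≤-low k≤n x) k≤x)

  position-high : ∀ z → k ≤ toℕ z → position z ≡ pos S z
  position-high z k≤z with view z
  ... | low x refl _ = ⊥-elim (<⇒≱ (inject≤-low k≤n x) k≤z)
  ... | high _ p     = p

  Q'-cell⇒S : ∀ {p} → Cell Q' p → ∃ λ y → pos S (inject≤ y k≤n) ≡ p
  Q'-cell⇒S = Equivalence.from (shape _)

  high-entry-not-in-Q' : ∀ x {z} → k ≤ toℕ z → pos S z ≢ pos Q' x
  high-entry-not-in-Q' x {z} k≤z e with Q'-cell⇒S (x , refl)
  ... | y , y↦ = <⇒≱ (inject≤-low k≤n y) (subst (λ w → k ≤ toℕ w) (injective S _ _ (trans e (sym y↦))) k≤z)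

  cell⇒position : ∀ {p} → Cell S p → ∃ λ z → position z ≡ p
  cell⇒position (y , y↦p) with lowOrHigh k≤n y
  ... | inj₂ k≤y        = y , trans (position-high y k≤y) y↦p
  ... | inj₁ (y₀ , refl) with Equivalence.to (shape _) (y₀ , y↦p)
  ...   | x , x↦p = inject≤ x k≤n , trans (position-low x) x↦p

  position-injective : ∀ z₁ z₂ → position z₁ ≡ position z₂ → z₁ ≡ z₂
  position-injective z₁ z₂ e with view z₁ | view z₂
  ... | low x₁ refl p₁ | low x₂ refl p₂ =
        cong (λ x → inject≤ x k≤n) (injective Q' _ _ (trans (sym p₁) (trans e p₂)))
  ... | high _ p₁      | high _ p₂      = injective S _ _ (trans (sym p₁) (trans e p₂))
  ... | low x₁ refl p₁ | high k≤z₂ p₂   =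
        ⊥-elim (high-entry-not-in-Q' x₁ k≤z₂ (trans (sym p₂) (trans (sym e) p₁)))
  ... | high k≤z₁ p₁   | low x₂ refl p₂ =
        ⊥-elim (high-entry-not-in-Q' x₂ k≤z₁ (trans (sym p₁) (trans e p₂)))

  position-downClosed : ∀ z r c → r ≤ proj₁ (position z) → c ≤ proj₂ (position z) →
                        ∃ λ y → position y ≡ (r , c)
  position-downClosed z r c r≤ c≤ with view z
  ... | low x refl p with cell-downClosed Q' (x , sym p) (r≤ , c≤)
  ...   | x' , x'↦ = inject≤ x' k≤n , trans (position-low x') x'↦
  position-downClosed z r c r≤ c≤ | high _ p = cell⇒position (cell-downClosed S (z , sym p) (r≤ , c≤))

  position-increasing : ∀ z₁ z₂ → proj₁ (position z₁) ≤ proj₁ (position z₂) →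
                        proj₂ (position z₁) ≤ proj₂ (position z₂) → toℕ z₁ ≤ toℕ z₂
  position-increasing z₁ z₂ r≤ c≤ with view z₁ | view z₂
  ... | low x₁ refl p₁ | low x₂ refl p₂ =
        subst₂ _≤_ (sym (toℕ-inject≤ x₁ k≤n)) (sym (toℕ-inject≤ x₂ k≤n))
          (entry-monotone Q' (sym p₁) (sym p₂) (r≤ , c≤))
  ... | high _ p₁      | high _ p₂      = entry-monotone S (sym p₁) (sym p₂) (r≤ , c≤)
  ... | low x₁ refl _  | high k≤z₂ _    = <⇒≤ (<-≤-trans (inject≤-low k≤n x₁) k≤z₂)
  ... | high k≤z₁ p₁   | low x₂ refl p₂ with Q'-cell⇒S (x₂ , refl)
  ...   | y , y↦ =
          ⊥-elim (<⇒≱ (≤-<-trans (entry-monotone S (sym p₁) (trans y↦ (sym p₂)) (r≤ , c≤)) (inject≤-low k≤n y)) k≤z₁)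

  result : SYT n
  result = record { pos = position ; injective = position-injective
                  ; downClosed = position-downClosed ; increasing = position-increasing }

  replaced : Replaced k≤n S Q' result
  replaced = position-low , position-high

replacement : ∀ {k n} (k≤n : k ≤ n) {S : SYT n} {Q Q' : SYT k} → Restricts k≤n S Q → SameShape Q Q' →
              Σ (SYT n) (Replaced k≤n S Q')
replacement k≤n {S} {Q} {Q'} S|Q Q~Q' = result , replaced
  where
  open Replacement k≤n S Q'
         (sameShape-trans {S = restrict k≤n S} {Q} {Q'} (≈ᵀ⇒sameShape {S = restrict k≤n S} {Q} S|Q) Q~Q')

adjacent-not-⊑ : ∀ {n} (T : SYT n) {u v} → toℕ v ≡ suc (toℕ u) → row T u ≢ row T v → col T u ≢ col T v →
                 ¬ pos T u ⊑ pos T v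
adjacent-not-⊑ T {u} {v} v≡1+u rows≢ cols≢ (r≤ , c≤) with cell-downClosed T (v , refl) (r≤ , ≤-refl {col T v})
... | q , q↦ = <⇒≱ (subst (toℕ q <_) v≡1+u q<v) u<q
  where
  u<q = entry-strictMono T refl q↦ (≤-refl , c≤) (λ e → cols≢ (cong proj₂ e))
  q<v = entry-strictMono T q↦ refl (r≤ , ≤-refl) (λ e → rows≢ (cong proj₁ e))

module AdjacentSwap {n} (T : SYT n) (u v : Fin n) (v≡1+u : toℕ v ≡ suc (toℕ u))
                    (rows≢ : row T u ≢ row T v) (cols≢ : col T u ≢ col T v) where

  σ-from : ∀ z → Dec (z ≡ u) → Dec (z ≡ v) → Fin n
  σ-from z (yes _) _       = v
  σ-from z (no _)  (yes _) = u
  σ-from z (no _)  (no _)  = z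

  σ : Fin n → Fin n
  σ z = σ-from z (z ≟ᶠ u) (z ≟ᶠ v)

  data View (z : Fin n) : Set where
    at-u  : z ≡ u → σ z ≡ v → View z
    at-v  : z ≡ v → σ z ≡ u → View z
    other : z ≢ u → z ≢ v → σ z ≡ z → View z

  view : ∀ z → View z
  view z with z ≟ᶠ u in eq-u | z ≟ᶠ v in eq-v
  ... | yes z≡u | _       = at-u z≡u (cong₂ (σ-from z) eq-u eq-v)
  ... | no z≢u  | yes z≡v = at-v z≡v (cong₂ (σ-from z) eq-u eq-v)
  ... | no z≢u  | no z≢v  = other z≢u z≢v (cong₂ (σ-from z) eq-u eq-v)

  u≢v : u ≢ v
  u≢v u≡v = rows≢ (cong (row T) u≡v)

  u≤v : toℕ u ≤ toℕ v
  u≤v = subst (toℕ u ≤_) (sym v≡1+u) (n≤1+n (toℕ u))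

  σ-u : σ u ≡ v
  σ-u with view u
  ... | at-u _ σu≡v  = σu≡v
  ... | at-v u≡v _   = ⊥-elim (u≢v u≡v)
  ... | other u≢u _ _ = ⊥-elim (u≢u refl)

  σ-v : σ v ≡ u
  σ-v with view v
  ... | at-u v≡u _    = ⊥-elim (u≢v (sym v≡u))
  ... | at-v _ σv≡u   = σv≡u
  ... | other _ v≢v _ = ⊥-elim (v≢v refl)

  σ-involutive : ∀ z → σ (σ z) ≡ z
  σ-involutive z with view z
  ... | at-u refl σu≡v = trans (cong σ σu≡v) σ-v
  ... | at-v refl σv≡u = trans (cong σ σv≡u) σ-u
  ... | other _ _ σz≡z = trans (cong σ σz≡z) σz≡z

  σ-monotone : ∀ z₁ z₂ → toℕ (σ z₁) ≤ toℕ (σ z₂) → toℕ z₁ ≤ toℕ z₂ ⊎ (z₁ ≡ v × z₂ ≡ u)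
  σ-monotone z₁ z₂ σz₁≤σz₂ with view z₁ | view z₂
  ... | at-u refl _  | at-u refl _  = inj₁ ≤-refl
  ... | at-u refl _  | at-v refl _  = inj₁ u≤v
  ... | at-u refl s₁ | other _ _ s₂ = inj₁ (≤-trans u≤v (subst₂ _≤_ (cong toℕ s₁) (cong toℕ s₂) σz₁≤σz₂))
  ... | at-v refl _  | at-u refl _  = inj₂ (refl , refl)
  ... | at-v refl _  | at-v refl _  = inj₁ ≤-refl
  ... | at-v refl s₁ | other z₂≢u _ s₂ =
        inj₁ (subst (_≤ toℕ z₂) (sym v≡1+u)
          (≤∧≢⇒< (subst₂ _≤_ (cong toℕ s₁) (cong toℕ s₂) σz₁≤σz₂) (λ e → z₂≢u (toℕ-injective (sym e)))))
  ... | other _ z₁≢v s₁ | at-u refl s₂ =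
        inj₁ (≤-pred (subst (toℕ z₁ <_) v≡1+u
          (≤∧≢⇒< (subst₂ _≤_ (cong toℕ s₁) (cong toℕ s₂) σz₁≤σz₂) (λ e → z₁≢v (toℕ-injective e)))))
  ... | other _ _ s₁ | at-v refl s₂ = inj₁ (≤-trans (subst₂ _≤_ (cong toℕ s₁) (cong toℕ s₂) σz₁≤σz₂) u≤v)
  ... | other _ _ s₁ | other _ _ s₂ = inj₁ (subst₂ _≤_ (cong toℕ s₁) (cong toℕ s₂) σz₁≤σz₂)

  swapped : SYT n
  swapped = record
    { pos        = pos T ∘ σ
    ; injective  = λ z₁ z₂ e →
        trans (sym (σ-involutive z₁)) (trans (cong σ (injective T _ _ e)) (σ-involutive z₂))
    ; downClosed = λ z r c r≤ c≤ → let (y , y↦) = downClosed T (σ z) r c r≤ c≤ in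
                   σ y , trans (cong (pos T) (σ-involutive y)) y↦
    ; increasing = increasing-σ
    }
    where
    increasing-σ : ∀ z₁ z₂ → row T (σ z₁) ≤ row T (σ z₂) → col T (σ z₁) ≤ col T (σ z₂) → toℕ z₁ ≤ toℕ z₂
    increasing-σ z₁ z₂ r≤ c≤ with σ-monotone z₁ z₂ (increasing T _ _ r≤ c≤)
    ... | inj₁ z₁≤z₂          = z₁≤z₂
    ... | inj₂ (refl , refl) =
          ⊥-elim (adjacent-not-⊑ T v≡1+u rows≢ cols≢ (subst₂ _⊑_ (cong (pos T) σ-v) (cong (pos T) σ-u) (r≤ , c≤)))

  swap : Swap T u v swapped
  swap = cong (pos T) σ-u , cong (pos T) σ-v , λ z z≢u z≢v → cong (pos T) (σ-other z≢u z≢v)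
    where
    σ-other : ∀ {z} → z ≢ u → z ≢ v → σ z ≡ z
    σ-other {z} z≢u z≢v with view z
    ... | at-u z≡u _    = ⊥-elim (z≢u z≡u)
    ... | at-v z≡v _    = ⊥-elim (z≢v z≡v)
    ... | other _ _ σz≡z = σz≡z

record _↝_ {n} (Q Q' : SYT n) : Set where
  constructor translation
  field
    a    : ℕ
    a+3≤n : suc (suc (suc a)) ≤ n
    step : Triple.V[i+1,i] a a+3≤n Q Q' ⊎ Triple.V[i,i+1] a a+3≤n Q Q'

_↝*_ : ∀ {n} → SYT n → SYT n → Set
_↝*_ = Star _↝_

swap-sym : ∀ {n} {T T' : SYT n} {x y} → Swap T x y T' → Swap T' x y T
swap-sym (x↦y , y↦x , others) = sym y↦x , sym x↦y , λ z z≢x z≢y → sym (others z z≢x z≢y)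

swap-cell : ∀ {n} {T T' : SYT n} {x y} → Swap T x y T' → ∀ {p} → Cell T p → Cell T' p
swap-cell {x = x} {y} (x↦y , y↦x , others) (z , z↦p) with z ≟ᶠ x | z ≟ᶠ y
... | yes refl | _        = y , trans y↦x z↦p
... | no _     | yes refl = x , trans x↦y z↦p
... | no z≢x   | no z≢y   = z , trans (others z z≢x z≢y) z↦p

swap-sameShape : ∀ {n} {T T' : SYT n} {x y} → Swap T x y T' → SameShape T T'
swap-sameShape {T = T} {T'} {x} {y} s p =
  mk⇔ (swap-cell {T = T} {T'} {x} {y} s) (swap-cell {T = T'} {T} {x} {y} (swap-sym {T = T} {T'} {x} {y} s))

↝-swap : ∀ {n} {Q Q' : SYT n} → Q ↝ Q' → ∃₂ λ x y → Swap Q x y Q'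
↝-swap (translation a p (inj₁ (inj₁ (_ , _ , s)))) = Triple.e₁ a p , Triple.e₂ a p , s
↝-swap (translation a p (inj₁ (inj₂ (_ , _ , s)))) = Triple.e₀ a p , Triple.e₁ a p , s
↝-swap (translation a p (inj₂ (inj₁ (_ , _ , s)))) = Triple.e₁ a p , Triple.e₂ a p , s
↝-swap (translation a p (inj₂ (inj₂ (_ , _ , s)))) = Triple.e₀ a p , Triple.e₁ a p , s

↝-sameShape : ∀ {n} {Q Q' : SYT n} → Q ↝ Q' → SameShape Q Q'
↝-sameShape {Q = Q} {Q'} Q↝Q' with ↝-swap Q↝Q'
... | x , y , s = swap-sameShape {T = Q} {Q'} {x} {y} s

↝*-sameShape : ∀ {n} {Q Q' : SYT n} → Q ↝* Q' → SameShape Q Q'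
↝*-sameShape {Q = Q} ε = ≈ᵀ⇒sameShape {S = Q} {T = Q} (λ _ → refl)
↝*-sameShape {Q = Q} {Q'} (_◅_ {j = Q₁} Q↝Q₁ Q₁↝*Q') =
  sameShape-trans {S = Q} {Q₁} {Q'} (↝-sameShape Q↝Q₁) (↝*-sameShape Q₁↝*Q')

module _ {n : ℕ} (a : ℕ) (p : suc (suc (suc a)) ≤ n) (T T' : SYT n) where
  open Triple a p

  V[i+1,i]-domain : V[i+1,i] T T' → Dom[i+1,i] T
  V[i+1,i]-domain (inj₁ (r₀<r₂ , r₁≤r₀ , _)) = ≤-<-trans r₁≤r₀ r₀<r₂ , λ r₀<r₁ → <⇒≱ r₀<r₁ r₁≤r₀
  V[i+1,i]-domain (inj₂ (r₂≤r₀ , r₁<r₂ , _)) = r₁<r₂ , λ r₀<r₁ → <⇒≱ (<-≤-trans r₁<r₂ r₂≤r₀) (<⇒≤ r₀<r₁)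

  V[i,i+1]-domain : V[i,i+1] T T' → Dom[i,i+1] T
  V[i,i+1]-domain (inj₁ (r₀<r₁ , r₂≤r₀ , _)) = r₀<r₁ , λ r₁<r₂ → <⇒≱ (≤-<-trans r₂≤r₀ r₀<r₁) (<⇒≤ r₁<r₂)
  V[i,i+1]-domain (inj₂ (r₂≤r₁ , r₀<r₂ , _)) = <-≤-trans r₀<r₂ r₂≤r₁ , λ r₁<r₂ → <⇒≱ r₁<r₂ r₂≤r₁

module Lift {k n : ℕ} (k≤n : k ≤ n) {S S' : SYT n} {Q Q' : SYT k}
            (S|Q : Restricts k≤n S Q) (S'-rep : Replaced k≤n S Q' S') where

  swap : ∀ {x y} → Swap Q x y Q' → Swap S (inject≤ x k≤n) (inject≤ y k≤n) S'
  swap {x} {y} (x↦y , y↦x , others) =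
    trans (proj₁ S'-rep x) (trans x↦y (sym (S|Q y))) ,
    trans (proj₁ S'-rep y) (trans y↦x (sym (S|Q x))) ,
    fixed
    where
    fixed : ∀ z → z ≢ inject≤ x k≤n → z ≢ inject≤ y k≤n → pos S' z ≡ pos S z
    fixed z z≢x z≢y with lowOrHigh k≤n z
    ... | inj₁ (w , refl) = trans (proj₁ S'-rep w) (trans (others w (z≢x ∘ cong inj) (z≢y ∘ cong inj)) (sym (S|Q w)))
      where inj = λ v → inject≤ v k≤n
    ... | inj₂ k≤z = proj₂ S'-rep z k≤z

  swap-fromℕ< : ∀ {i j} .(i<k : i < k) .(j<k : j < k) .(i<n : i < n) .(j<n : j < n) →
                Swap Q (fromℕ< i<k) (fromℕ< j<k) Q' → Swap S (fromℕ< i<n) (fromℕ< j<n) S'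
  swap-fromℕ< i<k j<k i<n j<n s =
    subst₂ (λ x y → Swap S x y S') (inject≤-fromℕ< i<k k≤n i<n) (inject≤-fromℕ< j<k k≤n j<n) (swap s)

  row-fromℕ< : ∀ {j} (j<k : j < k) → row S (fromℕ< (≤-trans j<k k≤n)) ≡ row Q (fromℕ< j<k)
  row-fromℕ< j<k = cong proj₁ (restricts-fromℕ< k≤n {S} {Q} S|Q j<k)

  module _ {a : ℕ} (p : suc (suc (suc a)) ≤ k) where
    private
      module Tk = Triple a p
      module Tn = Triple a (≤-trans p k≤n)

    V[i+1,i] : Tk.V[i+1,i] Q Q' → Tn.V[i+1,i] S S'
    V[i+1,i] v rewrite row-fromℕ< (≤-trans (n≤1+n _) (≤-trans (n≤1+n _) p))
               | row-fromℕ< (≤-trans (n≤1+n _) p)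
               | row-fromℕ< p =
      Sum.map (map₂ (map₂ (swap-fromℕ< _ _ _ _))) (map₂ (map₂ (swap-fromℕ< _ _ _ _))) v

    V[i,i+1] : Tk.V[i,i+1] Q Q' → Tn.V[i,i+1] S S'
    V[i,i+1] v rewrite row-fromℕ< (≤-trans (n≤1+n _) (≤-trans (n≤1+n _) p))
               | row-fromℕ< (≤-trans (n≤1+n _) p)
               | row-fromℕ< p =
      Sum.map (map₂ (map₂ (swap-fromℕ< _ _ _ _))) (map₂ (map₂ (swap-fromℕ< _ _ _ _))) v

  step : Q ↝ Q' → S ↝ S'
  step (translation a p v) = translation a (≤-trans p k≤n) (Sum.map (V[i+1,i] p) (V[i,i+1] p) v)

lift-↝* : ∀ {k n} (k≤n : k ≤ n) {S : SYT n} {Q Q' : SYT k} → Q ↝* Q' → Restricts k≤n S Q →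
          Σ (SYT n) λ S' → S ↝* S' × Replaced k≤n S Q' S'
lift-↝* k≤n {S} ε S|Q = S , ε , S|Q , λ _ _ → refl
lift-↝* k≤n {S} {Q} (_◅_ {j = Q₁} Q↝Q₁ Q₁↝*Q') S|Q with replacement k≤n {S} {Q} {Q₁} S|Q (↝-sameShape Q↝Q₁)
... | S₁ , S₁-rep with lift-↝* k≤n {S₁} Q₁↝*Q' (proj₁ S₁-rep)
...   | S' , S₁↝*S' , (S'|Q' , high) =
        S' , Lift.step k≤n S|Q S₁-rep Q↝Q₁ ◅ S₁↝*S' , S'|Q' , λ z k≤z → trans (high z k≤z) (proj₂ S₁-rep z k≤z)

greatest : ∀ {N p} {P : Pred (Fin N) p} → Decidable P → ∃ P → ∃ λ y → P y × (∀ {z} → P z → toℕ z ≤ toℕ y)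
greatest {suc N} P? (w , Pw) with any? (P? ∘ Fin.suc)
... | yes ∃P∘suc with greatest (P? ∘ Fin.suc) ∃P∘suc
...   | y , Py , y-max = Fin.suc y , Py , λ { {Fin.zero} _ → z≤n ; {Fin.suc z} Pz → s≤s (y-max Pz) }
greatest {suc N} P? (Fin.zero , P0)  | no ¬∃P∘suc =
  Fin.zero , P0 , λ { {Fin.zero} _ → z≤n ; {Fin.suc z} Pz → ⊥-elim (¬∃P∘suc (z , Pz)) }
greatest {suc N} P? (Fin.suc w , Pw) | no ¬∃P∘suc = ⊥-elim (¬∃P∘suc (w , Pw))

-- The entry a ≥ b at (t+1, c₀) blocks the cell below the greatest entry y < b of row t.
corner-in-row : ∀ {b N} (b≤N : b ≤ N) (T : SYT N) {a w : Fin N} {t c₀ : ℕ} →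
                pos T a ≡ (suc t , c₀) → b ≤ toℕ a → pos T w ≡ (t , c₀) → toℕ w < b →
                ∃ λ p → Corner (restrict b≤N T) p × proj₁ p ≡ t
corner-in-row {b} b≤N T {a} {w} {t} a↦ b≤a w↦ w<b
  with greatest (λ z → toℕ z <? b ×-dec row T z ≟ℕ t) (w , w<b , cong proj₁ w↦)
... | y , (y<b , y-row) , y-max = pos T y , (restrict-cell b≤N T refl y<b , no-below , no-right) , y-row
  where
  c₀≤col-y : proj₂ (pos T a) ≤ col T y
  c₀≤col-y = subst (_≤ col T y) (trans (cong proj₂ w↦) (sym (cong proj₂ a↦)))
    (same-row-col-monotone T (trans (cong proj₁ w↦) (sym y-row)) (y-max (w<b , cong proj₁ w↦)))

  no-below : ¬ Cell (restrict b≤N T) (below (pos T y))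
  no-below cell with restrict-cell⁻ b≤N T cell
  ... | z , z↦ , z<b =
        <⇒≱ z<b (≤-trans b≤a (entry-monotone T refl z↦
          (≤-reflexive (trans (cong proj₁ a↦) (cong suc (sym y-row))) , c₀≤col-y)))

  no-right : ¬ Cell (restrict b≤N T) (right (pos T y))
  no-right cell with restrict-cell⁻ b≤N T cell
  ... | z , z↦ , z<b =
        <⇒≱ (entry-strictMono T refl z↦ (≤-refl , n≤1+n _) (1+n≢n ∘ sym ∘ cong proj₂))
            (y-max (z<b , trans (cong proj₁ z↦) y-row))

last : ∀ m → Fin (suc m)
last m = fromℕ< (n<1+n m)

dropLast : ∀ {m} → SYT (suc m) → SYT m
dropLast {m} = restrict (n≤1+n m)

above-last : ∀ {m} (z : Fin (suc m)) → m ≤ toℕ z → z ≡ last m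
above-last {m} z m≤z = toℕ-injective (trans (≤-antisym (≤-pred (toℕ<n z)) m≤z) (sym (toℕ-fromℕ< (n<1+n m))))

module _ {m : ℕ} (T : SYT (suc m)) where

  last-maximal : ∀ {z} → pos T (last m) ⊑ pos T z → z ≡ last m
  last-maximal {z} last⊑z =
    above-last z (subst (_≤ toℕ z) (toℕ-fromℕ< (n<1+n m)) (entry-monotone T refl refl last⊑z))

  nothing-after-last : ∀ {p} → pos T (last m) ⊑ p → p ≢ pos T (last m) → ¬ Cell T p
  nothing-after-last last⊑p p≢last (z , z↦p) with last-maximal (subst (pos T (last m) ⊑_) (sym z↦p) last⊑p)
  ... | refl = p≢last (sym z↦p)

  last-corner : Corner T (pos T (last m))
  last-corner = (last m , refl)
              , nothing-after-last (n≤1+n _ , ≤-refl) (1+n≢n ∘ cong proj₁)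
              , nothing-after-last (≤-refl , n≤1+n _) (1+n≢n ∘ cong proj₂)

  dropLast-cell : ∀ {p} → Cell T p → p ≢ pos T (last m) → Cell (dropLast T) p
  dropLast-cell (y , y↦p) p≢last = restrict-cell (n≤1+n m) T y↦p (≤∧≢⇒< (≤-pred (toℕ<n y)) y≢last)
    where
    y≢last : toℕ y ≢ m
    y≢last y≡m = p≢last (trans (sym y↦p) (cong (pos T) (toℕ-injective (trans y≡m (sym (toℕ-fromℕ< (n<1+n m)))))))

  dropLast-cell-≢ : ∀ {p} → Cell (dropLast T) p → p ≢ pos T (last m)
  dropLast-cell-≢ cell p≡last with restrict-cell⁻ (n≤1+n m) T cell
  ... | z , z↦p , z<m = <-irrefl (toℕ-fromℕ< (n<1+n m))
        (subst (λ x → toℕ x < m) (injective T _ _ (trans z↦p p≡last)) z<m)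

  dropLast-corner : ∀ {c} → Corner T c → c ≢ pos T (last m) → Corner (dropLast T) c
  dropLast-corner (cell , no-below , no-right) c≢last =
    dropLast-cell cell c≢last , no-below ∘ forget , no-right ∘ forget
    where
    forget : ∀ {p} → Cell (dropLast T) p → Cell T p
    forget (x , x↦p) = inject≤ x (n≤1+n m) , x↦p

dropLast-sameShape : ∀ {m} {T T' : SYT (suc m)} → SameShape T T' → pos T (last m) ≡ pos T' (last m) →
                     SameShape (dropLast T) (dropLast T')
dropLast-sameShape {m} {T} {T'} T~T' same-last p =
  mk⇔ (transfer {T} {T'} T~T' same-last) (transfer {T'} {T} (sameShape-sym {S = T} {T'} T~T') (sym same-last))
  where
  transfer : ∀ {U U' : SYT (suc m)} → SameShape U U' → pos U (last m) ≡ pos U' (last m) →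
             Cell (dropLast U) p → Cell (dropLast U') p
  transfer {U} {U'} U~U' same cell@(x , x↦p) =
    dropLast-cell U' (Equivalence.to (U~U' p) (inject≤ x (n≤1+n m) , x↦p))
      (λ p≡ → dropLast-cell-≢ U cell (trans p≡ (sym same)))

penultimate : ∀ m → Fin (suc (suc m))
penultimate m = fromℕ< (≤-trans (n<1+n m) (n≤1+n (suc m)))

module _ {n : ℕ} (T : SYT n) where

  corners-same-row : ∀ {c d} → Corner T c → Corner T d → proj₁ c ≡ proj₁ d → c ≡ d
  corners-same-row {c} {d} (c-cell , _ , c-no-right) (d-cell , _ , d-no-right) same-row
    with <-cmp (proj₂ c) (proj₂ d)
  ... | tri< c-left _ _  = ⊥-elim (c-no-right (cell-downClosed T d-cell (≤-reflexive same-row , c-left)))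
  ... | tri≈ _ same-col _ = cong₂ _,_ same-row same-col
  ... | tri> _ _ d-left  = ⊥-elim (d-no-right (cell-downClosed T c-cell (≤-reflexive (sym same-row) , d-left)))

  corner-column-free : ∀ {c d} → Corner T c → Cell T d → proj₁ c < proj₁ d → proj₂ c ≢ proj₂ d
  corner-column-free (_ , c-no-below , _) d-cell c-above same-col =
    c-no-below (cell-downClosed T d-cell (c-above , ≤-reflexive same-col))

  entry-above : ∀ {a t c₀} → pos T a ≡ (suc t , c₀) → ∃ λ w → pos T w ≡ (t , c₀) × toℕ w < toℕ a
  entry-above a↦ with cell-downClosed T (_ , a↦) (n≤1+n _ , ≤-refl)
  ... | w , w↦ = w , w↦ , entry-strictMono T w↦ a↦ (n≤1+n _ , ≤-refl) (1+n≢n ∘ sym ∘ cong proj₁)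

pred-split : ∀ {a b} → a < b → ∃ λ t → b ≡ suc t × a ≤ t
pred-split (s≤s a≤t) = _ , refl , a≤t

Straddle : ℕ → ℕ → ℕ → Set
Straddle t r r' = (r ≤ t × r' ≡ suc t) ⊎ (r ≡ suc t × r' ≤ t)

straddle-≢ : ∀ {t r r'} → Straddle t r r' → r ≢ r'
straddle-≢ {t} (inj₁ (r≤t , r'≡1+t)) refl = <-irrefl refl (subst (_≤ t) r'≡1+t r≤t)
straddle-≢ {t} (inj₂ (r≡1+t , r'≤t)) refl = <-irrefl refl (subst (_≤ t) r≡1+t r'≤t)

exchange-geometry : ∀ {m} (T : SYT (suc (suc m))) {c} → pos T (penultimate m) ≡ c → Corner T c →
  c ≢ pos T (last (suc m)) →
  ∃ λ t → Straddle t (proj₁ c) (row T (last (suc m))) × proj₂ c ≢ col T (last (suc m)) ×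
          ∃ λ p → Corner (restrict (m≤n+m m 2) T) p × proj₁ p ≡ t
exchange-geometry {m} T {c} pen↦c corner c≢d with <-cmp (proj₁ c) (row T (last (suc m)))
... | tri≈ _ same-row _ = ⊥-elim (c≢d (corners-same-row T corner (last-corner T) same-row))
... | tri< c-above _ _ with pred-split c-above
...   | t , d-row , c-row with entry-above T {last (suc m)} (cong (_, col T (last (suc m))) d-row)
...     | w , w↦ , w<last =
          t , inj₁ (c-row , d-row) , corner-column-free T corner (_ , refl) c-above ,
          corner-in-row (m≤n+m m 2) T (cong (_, col T (last (suc m))) d-row) m≤last w↦ (≤∧≢⇒< w≤m w≢m)
  where
  m≤last : m ≤ toℕ (last (suc m))
  m≤last = subst (m ≤_) (sym (toℕ-fromℕ< (n<1+n (suc m)))) (n≤1+n m)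
  w≤m : toℕ w ≤ m
  w≤m = ≤-pred (subst (toℕ w <_) (toℕ-fromℕ< (n<1+n (suc m))) w<last)
  w≢m : toℕ w ≢ m
  w≢m w≡m = proj₁ (proj₂ corner) (last (suc m) , trans (cong (_, col T (last (suc m))) d-row) (cong below (sym c↦)))
    where
    c↦ : c ≡ (t , col T (last (suc m)))
    c↦ = trans (sym pen↦c) (trans (cong (pos T) (toℕ-injective (trans (toℕ-fromℕ< _) (sym w≡m)))) w↦)
exchange-geometry {m} T {c} pen↦c corner c≢d | tri> _ _ d-above with pred-split d-above
...   | t , c-row , d-row with entry-above T {penultimate m} (trans pen↦c (cong (_, proj₂ c) c-row))
...     | w , w↦ , w<pen =
          t , inj₂ (c-row , d-row) ,
          (λ same-col → corner-column-free T (last-corner T) (_ , pen↦c) d-above (sym same-col)) ,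
          corner-in-row (m≤n+m m 2) T (trans pen↦c (cong (_, proj₂ c) c-row)) (≤-reflexive (sym (toℕ-fromℕ< _))) w↦
            (subst (toℕ w <_) (toℕ-fromℕ< _) w<pen)

module _ (m : ℕ) where
  open Triple m (≤-refl {suc (suc (suc m))})

  last-two-translation : (T : SYT (suc (suc (suc m)))) {t : ℕ} {c d : ℕ × ℕ} →
    row T e₀ ≡ t → pos T e₁ ≡ c → pos T e₂ ≡ d → Straddle t (proj₁ c) (proj₁ d) → proj₂ c ≢ proj₂ d →
    Σ (SYT (suc (suc (suc m)))) λ T' → T ↝ T' × pos T' e₂ ≡ c
  last-two-translation T refl refl refl straddle cols≢ =
    swapped , translation m ≤-refl (translation-of straddle) , proj₁ (proj₂ swap)
    where
    e₂≡1+e₁ : toℕ e₂ ≡ suc (toℕ e₁)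
    e₂≡1+e₁ = trans (toℕ-fromℕ< (n<1+n (suc (suc m)))) (cong suc (sym (toℕ-fromℕ< (n≤1+n (suc (suc m))))))
    open AdjacentSwap T e₁ e₂ e₂≡1+e₁ (straddle-≢ straddle) cols≢
    translation-of : Straddle (row T e₀) (row T e₁) (row T e₂) → V[i+1,i] T swapped ⊎ V[i,i+1] T swapped
    translation-of (inj₁ (r₁≤r₀ , r₂≡1+r₀)) = inj₁ (inj₁ (≤-reflexive (sym r₂≡1+r₀) , r₁≤r₀ , swap))
    translation-of (inj₂ (r₁≡1+r₀ , r₂≤r₀)) = inj₂ (inj₁ (≤-reflexive (sym r₁≡1+r₀) , r₂≤r₀ , swap))

MovesLast : ℕ → Set
MovesLast m = (R : SYT (suc m)) {c : ℕ × ℕ} → Corner R c → Σ (SYT (suc m)) λ R' → R ↝* R' × pos R' (last m) ≡ c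

bring-to-corner : ∀ {m} → MovesLast m → (R : SYT (suc (suc m))) {c : ℕ × ℕ} → Corner R c →
  c ≢ pos R (last (suc m)) →
  Σ (SYT (suc (suc m))) λ R' → R ↝* R' × pos R' (penultimate m) ≡ c × pos R' (last (suc m)) ≡ pos R (last (suc m))
bring-to-corner {m} moveLast R corner c≢last with moveLast (dropLast R) (dropLast-corner R corner c≢last)
... | Q , R|↝*Q , Q-last with lift-↝* (n≤1+n (suc m)) R|↝*Q (restrict-restricts (n≤1+n (suc m)) R)
...   | R' , R↝*R' , R'-rep =
        R' , R↝*R' , trans (restricts-fromℕ< (n≤1+n (suc m)) {R'} {Q} (proj₁ R'-rep) (n<1+n m)) Q-last ,
        replaced-fromℕ< (n≤1+n (suc m)) {R} {R'} {Q} R'-rep ≤-refl (n<1+n (suc m))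

exchange-last-two : ∀ m → (∀ {j} → j < m → MovesLast j) → (T : SYT (suc (suc m))) {c : ℕ × ℕ} →
  pos T (penultimate m) ≡ c → Corner T c → c ≢ pos T (last (suc m)) →
  Σ (SYT (suc (suc m))) λ T' → T ↝* T' × pos T' (last (suc m)) ≡ c
exchange-last-two zero IH T pen↦c corner c≢last with exchange-geometry T pen↦c corner c≢last
... | _ , _ , _ , _ , empty-corner , _ = ⊥-elim (no-corner-in-empty (restrict (m≤n+m 0 2) T) empty-corner)
exchange-last-two (suc m) IH T {c} pen↦c corner c≢last with exchange-geometry T pen↦c corner c≢last
... | t , straddle , cols≢ , p , p-corner , p-row with IH (n<1+n m) (restrict (m≤n+m (suc m) 2) T) p-corner
...   | Q , T|↝*Q , Q-last with lift-↝* (m≤n+m (suc m) 2) T|↝*Q (restrict-restricts (m≤n+m (suc m) 2) T)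
...     | T₃ , T↝*T₃ , T₃-rep with last-two-translation m T₃ e₀-row e₁↦ e₂↦ straddle cols≢
  where
  open Triple m ≤-refl
  e₀-row : row T₃ e₀ ≡ t
  e₀-row = trans (cong proj₁ (trans (restricts-fromℕ< (m≤n+m (suc m) 2) {T₃} {Q} (proj₁ T₃-rep) (n<1+n m)) Q-last))
                 p-row
  e₁↦ : pos T₃ e₁ ≡ c
  e₁↦ = trans (replaced-fromℕ< (m≤n+m (suc m) 2) {T} {T₃} {Q} T₃-rep ≤-refl (n≤1+n _)) pen↦c
  e₂↦ : pos T₃ e₂ ≡ pos T (last (suc (suc m)))
  e₂↦ = replaced-fromℕ< (m≤n+m (suc m) 2) {T} {T₃} {Q} T₃-rep (n≤1+n _) (n<1+n _)
...       | T₄ , T₃↝T₄ , T₄-last = T₄ , T↝*T₃ ◅◅ (T₃↝T₄ ◅ ε) , T₄-last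

moveLast-step : ∀ m → (∀ {j} → j < m → MovesLast j) → MovesLast m
moveLast-step m IH R {c} corner with ≡-dec _≟ℕ_ _≟ℕ_ c (pos R (last m))
... | yes c≡last = R , ε , sym c≡last
moveLast-step zero IH R ((Fin.zero , 0↦c) , _) | no c≢last = ⊥-elim (c≢last (sym 0↦c))
moveLast-step (suc m) IH R corner | no c≢last with bring-to-corner (IH (n<1+n m)) R corner c≢last
... | R₂ , R↝*R₂ , pen↦c , same-last
      with exchange-last-two m (IH ∘ m<n⇒m<1+n) R₂ pen↦c
             (sameShape-corner {S = R} {R₂} (↝*-sameShape R↝*R₂) corner) (λ c≡last → c≢last (trans c≡last same-last))
...   | R₃ , R₂↝*R₃ , R₃-last = R₃ , R↝*R₂ ◅◅ R₂↝*R₃ , R₃-last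

moveLast : ∀ m → MovesLast m
moveLast = <-rec MovesLast moveLast-step

connect : ∀ {m} (R R' : SYT m) → SameShape R R' → Σ (SYT m) λ R'' → R ↝* R'' × R'' ≈ᵀ R'
connect {zero} R R' _ = R , ε , λ ()
connect {suc m} R R' R~R'
  with moveLast m R (sameShape-corner {S = R'} {R} (sameShape-sym {S = R} {R'} R~R') (last-corner R'))
... | R₂ , R↝*R₂ , R₂-last
      with connect (dropLast R₂) (dropLast R')
             (dropLast-sameShape {T = R₂} {R'}
               (sameShape-trans {S = R₂} {R} {R'} (sameShape-sym {S = R} {R₂} (↝*-sameShape R↝*R₂)) R~R') R₂-last)
...   | Q , R₂|↝*Q , Q≈R'| with lift-↝* (n≤1+n m) R₂|↝*Q (restrict-restricts (n≤1+n m) R₂)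
...     | R₃ , R₂↝*R₃ , (R₃|Q , high) =
          R₃ , R↝*R₂ ◅◅ R₂↝*R₃ ,
          ≈ᵀ-from-parts (n≤1+n m) {R₃} {R'} {dropLast R'} (λ x → trans (R₃|Q x) (Q≈R'| x))
            (restrict-restricts (n≤1+n m) R') same-last
  where
  same-last : ∀ z → m ≤ toℕ z → pos R₃ z ≡ pos R' z
  same-last z m≤z with above-last z m≤z
  ... | refl = trans (high _ m≤z) R₂-last

replaceSub : ∀ {k n} (k≤n : k ≤ n) {Q Q' : SYT k} → SameShape Q Q' → SubSYT k≤n Q → SubSYT k≤n Q'
replaceSub k≤n {Q} {Q'} Q~Q' (T , T|Q) = let (T' , T'|Q' , _) = replacement k≤n {T} {Q} {Q'} T|Q Q~Q' in T' , T'|Q'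

replaceSub-replaced : ∀ {k n} (k≤n : k ≤ n) {Q Q' : SYT k} (Q~Q' : SameShape Q Q') (x : SubSYT k≤n Q) →
                      Replaced k≤n (proj₁ x) Q' (proj₁ (replaceSub k≤n {Q} {Q'} Q~Q' x))
replaceSub-replaced k≤n {Q} {Q'} Q~Q' (T , T|Q) = proj₂ (replacement k≤n {T} {Q} {Q'} T|Q Q~Q')

replaceSub-inverse : ∀ {k n} (k≤n : k ≤ n) {Q Q' : SYT k} (Q~Q' : SameShape Q Q') (Q'~Q : SameShape Q' Q)
                     (x : SubSYT k≤n Q) →
                     proj₁ (replaceSub k≤n {Q'} {Q} Q'~Q (replaceSub k≤n {Q} {Q'} Q~Q' x)) ≈ᵀ proj₁ x
replaceSub-inverse k≤n {Q} {Q'} Q~Q' Q'~Q x =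
  replaced-twice k≤n {proj₁ x} {proj₁ x'} {proj₁ (replaceSub k≤n {Q'} {Q} Q'~Q x')} {Q} {Q'}
    (proj₂ x) (replaceSub-replaced k≤n {Q} {Q'} Q~Q' x) (replaceSub-replaced k≤n {Q'} {Q} Q'~Q x')
  where x' = replaceSub k≤n {Q} {Q'} Q~Q' x

module OrderTransfer {ℓ n} (_≼_ : Rel (SYT n) ℓ) (≼-po : IsPartialOrder _≈ᵀ_ _≼_)
                     (itp : InnerTranslationProperty _≼_) {k : ℕ} (k≤n : k ≤ n) where
  open IsPartialOrder ≼-po using (reflexive; module Eq) renaming (trans to ≼-trans)

  ↝-transfers-order : ∀ {S T S' T' : SYT n} {Q Q' : SYT k} → Q ↝ Q' →
    Restricts k≤n S Q → Restricts k≤n T Q → Replaced k≤n S Q' S' → Replaced k≤n T Q' T' → S ≼ T → S' ≼ T'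
  ↝-transfers-order {S} {T} {S'} {T'} {Q} {Q'} (translation a p (inj₁ v)) S|Q T|Q S'-rep T'-rep =
    proj₁ (itp a p') S T S' T' (V[i+1,i]-domain a p' S S' vS) (V[i+1,i]-domain a p' T T' vT) vS vT
    where
    p' = ≤-trans p k≤n
    vS = Lift.V[i+1,i] k≤n {S} {S'} {Q} {Q'} S|Q S'-rep p v
    vT = Lift.V[i+1,i] k≤n {T} {T'} {Q} {Q'} T|Q T'-rep p v
  ↝-transfers-order {S} {T} {S'} {T'} {Q} {Q'} (translation a p (inj₂ v)) S|Q T|Q S'-rep T'-rep =
    proj₂ (itp a p') S T S' T' (V[i,i+1]-domain a p' S S' vS) (V[i,i+1]-domain a p' T T' vT) vS vT
    where
    p' = ≤-trans p k≤n
    vS = Lift.V[i,i+1] k≤n {S} {S'} {Q} {Q'} S|Q S'-rep p v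
    vT = Lift.V[i,i+1] k≤n {T} {T'} {Q} {Q'} T|Q T'-rep p v

  ↝*-transfers-order : ∀ {S T S' T' : SYT n} {Q Q' : SYT k} → Q ↝* Q' →
    Restricts k≤n S Q → Restricts k≤n T Q → Replaced k≤n S Q' S' → Replaced k≤n T Q' T' → S ≼ T → S' ≼ T'
  ↝*-transfers-order {S} {T} {S'} {T'} {Q} ε S|Q T|Q S'-rep T'-rep S≼T =
    ≼-trans (reflexive (replaced-self k≤n {S} {S'} {Q} S|Q S'-rep))
      (≼-trans S≼T (reflexive (Eq.sym {T'} {T} (replaced-self k≤n {T} {T'} {Q} T|Q T'-rep))))
  ↝*-transfers-order {S} {T} {S'} {T'} {Q} {Q'} (_◅_ {j = Q₁} Q↝Q₁ Q₁↝*Q') S|Q T|Q S'-rep T'-rep S≼T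
    with replacement k≤n {S} {Q} {Q₁} S|Q (↝-sameShape Q↝Q₁) | replacement k≤n {T} {Q} {Q₁} T|Q (↝-sameShape Q↝Q₁)
  ... | S₁ , S₁-rep | T₁ , T₁-rep =
    ↝*-transfers-order {S₁} {T₁} {S'} {T'} Q₁↝*Q' (proj₁ S₁-rep) (proj₁ T₁-rep)
      (replaced-rebase k≤n {S} {S₁} {S'} {Q₁} {Q'} S₁-rep S'-rep)
      (replaced-rebase k≤n {T} {T₁} {T'} {Q₁} {Q'} T₁-rep T'-rep)
      (↝-transfers-order Q↝Q₁ S|Q T|Q S₁-rep T₁-rep S≼T)

  sameShape-transfers-order : ∀ {S T S' T' : SYT n} {Q Q' : SYT k} → SameShape Q Q' →
    Restricts k≤n S Q → Restricts k≤n T Q → Replaced k≤n S Q' S' → Replaced k≤n T Q' T' → S ≼ T → S' ≼ T'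
  sameShape-transfers-order {Q = Q} {Q'} Q~Q' S|Q T|Q (S'|Q' , S'-high) (T'|Q' , T'-high) with connect Q Q' Q~Q'
  ... | Q'' , Q↝*Q'' , Q''≈Q' =
        ↝*-transfers-order Q↝*Q'' S|Q T|Q ((λ j → trans (S'|Q' j) (sym (Q''≈Q' j))) , S'-high)
                                         ((λ j → trans (T'|Q' j) (sym (Q''≈Q' j))) , T'-high)

  replaced-order-⇔ : ∀ {Q Q' : SYT k} → SameShape Q Q' → ∀ (S T S' T' : SYT n) →
    Restricts k≤n S Q → Restricts k≤n T Q → Replaced k≤n S Q' S' → Replaced k≤n T Q' T' → (S ≼ T) ⇔ (S' ≼ T')
  replaced-order-⇔ {Q} {Q'} Q~Q' S T S' T' S|Q T|Q S'-rep T'-rep = mk⇔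
    (sameShape-transfers-order {S} {T} {S'} {T'} {Q} {Q'} Q~Q' S|Q T|Q S'-rep T'-rep)
    (sameShape-transfers-order {S'} {T'} {S} {T} {Q'} {Q} (sameShape-sym {S = Q} {Q'} Q~Q')
      (proj₁ S'-rep) (proj₁ T'-rep)
      (replaced-sym k≤n {S} {S'} {Q} {Q'} S|Q S'-rep) (replaced-sym k≤n {T} {T'} {Q} {Q'} T|Q T'-rep))

corollary6p3 : ∀ {ℓ : Level} (n : ℕ) (_≼_ : Rel (SYT n) ℓ) →
  IsPartialOrder _≈ᵀ_ _≼_ → InnerTranslationProperty _≼_ →
  ∀ (k : ℕ) → 1 ≤ k → (k<n : k < n) → (k≤n : k ≤ n) → (R R' : SYT k) →
  SameShape R R' →
  (∀ (S T S' T' : SYT n) → Restricts k≤n S R → Restricts k≤n T R →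
     Replaced k≤n S R' S' → Replaced k≤n T R' T' →
     (S ≼ T) ⇔ (S' ≼ T'))
  ×
  (Σ (SubSYT k≤n R → SubSYT k≤n R') λ f →
   Σ (SubSYT k≤n R' → SubSYT k≤n R) λ g →
     (∀ x → proj₁ (g (f x)) ≈ᵀ proj₁ x) ×
     (∀ y → proj₁ (f (g y)) ≈ᵀ proj₁ y) ×
     (∀ x y → (proj₁ x ≼ proj₁ y) ⇔ (proj₁ (f x) ≼ proj₁ (f y))))
corollary6p3 n _≼_ ≼-po itp k _ _ k≤n R R' R~R' =
  replaced-order-⇔ {R} {R'} R~R' ,
  replaceSub k≤n {R} {R'} R~R' , replaceSub k≤n {R'} {R} R'~R ,
  replaceSub-inverse k≤n R~R' R'~R , replaceSub-inverse k≤n R'~R R~R' ,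
  λ x y → replaced-order-⇔ {R} {R'} R~R' _ _ _ _ (proj₂ x) (proj₂ y)
            (replaceSub-replaced k≤n {R} {R'} R~R' x) (replaceSub-replaced k≤n {R} {R'} R~R' y)
  where
  open OrderTransfer _≼_ ≼-po itp k≤n
  R'~R = sameShape-sym {S = R} {R'} R~R'
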